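{- Let $m\ge0$, $\lambda,\mu$ partitions of $m$, and $n_0,n\in N(m)$ with $n_0<n$. If $V^{n_0}(\lambda)\cap V^{n_0}(\mu)\neq\emptyset$, then $V^{n}(\lambda)\cap V^{n}(\mu)\neq\emptyset$.
   Context: $N(m)=\{n\in\mathbb Z: n\ge m,\ n\equiv m\pmod 2\}$. A skew shape is a vertical strip if it has at most one box in each row. For a partition $\lambda$, $V^n(\lambda)$ is the set of partitions $\nu$ with $|\nu|=n$ for which there is a chain $\lambda=\nu^0\subseteq\nu^1\subseteq\dots\subseteq\nu^t=\nu$ of partitions with each $\nu^s/\nu^{s-1}$ a vertical strip of even size. -}

module Defs where

open import Data.Nat using (ℕ; zero; suc; _+_; _≤_; _<_; _∸_)
open import Data.Nat.Properties using ()
open import Data.Nat.Base using (_≥_)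
open import Data.Nat.Divisibility using (_∣_)

Even : ℕ → Set
Even k = 2 ∣ k
open import Data.List using (List; []; _∷_)
open import Data.Nat.ListAction using (sum)
open import Data.List.Relation.Unary.All using (All)
open import Data.List.Relation.Unary.Linked using (Linked)
open import Data.Product using (_×_; ∃-syntax; _,_; proj₁)
open import Relation.Binary.Construct.Closure.ReflexiveTransitive using (Star)
open import Relation.Binary.PropositionalEquality using (_≡_)

IsPartition : List ℕ → Set
IsPartition xs = Linked _≥_ xs × All (λ x → 0 < x) xs

Partition : Set
Partition = ∃[ xs ] IsPartition xs

size : Partition → ℕ
size (xs , _) = sum xs

-- i-th part (0-indexed), with value 0 beyond the length.
part : List ℕ → ℕ → ℕ
part []       _       = 0
part (x ∷ _)  zero    = x
part (_ ∷ xs) (suc i) = part xs i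

_⊆ₚ_ : Partition → Partition → Set
(l , _) ⊆ₚ (v , _) = ∀ i → part l i ≤ part v i

-- ν/λ is a skew shape that is a vertical strip (at most one box per row).
IsVerticalStrip : Partition → Partition → Set
IsVerticalStrip (l , _) (v , _) = ∀ i → part v i ≤ suc (part l i)

EvenVStep : Partition → Partition → Set
EvenVStep l v = (l ⊆ₚ v) × IsVerticalStrip l v × Even (size v ∸ size l)

_∈V[_]_ : Partition → ℕ → Partition → Set
v ∈V[ n ] l = (size v ≡ n) × Star EvenVStep l v

-- N(m) = { n ∈ ℤ : n ≥ m, n ≡ m mod 2 }; since m ≥ 0 these are naturals.
_∈N_ : ℕ → ℕ → Set
n ∈N m = (m ≤ n) × Even (n ∸ m)

-- Appending k parts equal to 1 to a partition ν adds a column of k boxes below its last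
-- row, which is a vertical strip of size k.  So if ν lies in V^{n₀}(λ) ∩ V^{n₀}(μ), one more step with a column of
-- the even length n − n₀ puts the enlarged partition in V^n(λ) ∩ V^n(μ).
module Submission where

open import Defs
open import Data.Nat using (ℕ; _<_; zero; suc; _+_; _∸_; _≤_; z≤n; s≤s; _≥_)
open import Data.Nat.Properties
  using (≤-refl; n≤1+n; <⇒≤; m+[n∸m]≡n; m+n∸m≡n; +-∸-comm)
open import Data.Nat.Divisibility using (∣m+n∣m⇒∣n)
open import Data.Nat.ListAction using (sum)
open import Data.Nat.ListAction.Properties using (sum-++)
open import Data.List using (List; []; _∷_; _++_; replicate)
open import Data.List.Relation.Unary.All using (All; _∷_)
open import Data.List.Relation.Unary.All.Properties using (++⁺; replicate⁺)
open import Data.List.Relation.Unary.Linked using (Linked; []; [-]; _∷_)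
open import Data.Product using (_×_; ∃-syntax; _,_)
open import Relation.Binary.Construct.Closure.ReflexiveTransitive using (ε; _◅_; _◅◅_)
open import Relation.Binary.PropositionalEquality using (_≡_; refl; cong; subst; trans; sym)

column : ℕ → List ℕ
column k = replicate k 1

column-decreasing : ∀ k → Linked _≥_ (column k)
column-decreasing zero          = []
column-decreasing (suc zero)    = [-]
column-decreasing (suc (suc k)) = ≤-refl ∷ column-decreasing (suc k)

++column-decreasing : ∀ {xs} k → Linked _≥_ xs → All (0 <_) xs →
                      Linked _≥_ (xs ++ column k)
++column-decreasing k       []                 _            = column-decreasing k
++column-decreasing zero    [-]                _            = [-]
++column-decreasing (suc k) [-]                (0<x ∷ _)    = 0<x ∷ column-decreasing (suc k)
++column-decreasing k       (x≥y ∷ decreasing) (_ ∷ positive) =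
  x≥y ∷ ++column-decreasing k decreasing positive

++column-isPartition : ∀ {xs} k → IsPartition xs → IsPartition (xs ++ column k)
++column-isPartition k (decreasing , positive) =
  ++column-decreasing k decreasing positive , ++⁺ positive (replicate⁺ k (s≤s z≤n))

addColumn : Partition → ℕ → Partition
addColumn (xs , isPartition) k = xs ++ column k , ++column-isPartition k isPartition

sum-column : ∀ k → sum (column k) ≡ k
sum-column zero    = refl
sum-column (suc k) = cong suc (sum-column k)

size-addColumn : ∀ ν k → size (addColumn ν k) ≡ size ν + k
size-addColumn (xs , _) k = trans (sum-++ xs (column k)) (cong (sum xs +_) (sum-column k))

part-column : ∀ k i → part (column k) i ≤ 1
part-column zero    i       = z≤n
part-column (suc k) zero    = ≤-refl
part-column (suc k) (suc i) = part-column k i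

part-≤-part-++column : ∀ xs k i → part xs i ≤ part (xs ++ column k) i
part-≤-part-++column []       k i       = z≤n
part-≤-part-++column (x ∷ xs) k zero    = ≤-refl
part-≤-part-++column (x ∷ xs) k (suc i) = part-≤-part-++column xs k i

part-++column-≤-suc : ∀ xs k i → part (xs ++ column k) i ≤ suc (part xs i)
part-++column-≤-suc []       k i       = part-column k i
part-++column-≤-suc (x ∷ xs) k zero    = n≤1+n x
part-++column-≤-suc (x ∷ xs) k (suc i) = part-++column-≤-suc xs k i

addColumn-evenVStep : ∀ ν {k} → Even k → EvenVStep ν (addColumn ν k)
addColumn-evenVStep ν@(xs , _) {k} even-k =
  part-≤-part-++column xs k , part-++column-≤-suc xs k , subst Even (sym added) even-k
  where
  added : size (addColumn ν k) ∸ size ν ≡ k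
  added = trans (cong (_∸ size ν) (size-addColumn ν k)) (m+n∸m≡n (size ν) k)

addColumn-∈V : ∀ {l ν n₀ k} → ν ∈V[ n₀ ] l → Even k → addColumn ν k ∈V[ n₀ + k ] l
addColumn-∈V {ν = ν} {k = k} (size-ν , chain) even-k =
  trans (size-addColumn ν k) (cong (_+ k) size-ν) , chain ◅◅ (addColumn-evenVStep ν even-k ◅ ε)

∈N-difference-even : ∀ {m n₀ n} → n₀ ∈N m → n ∈N m → n₀ ≤ n → Even (n ∸ n₀)
∈N-difference-even {m} {n₀} {n} (m≤n₀ , even-n₀-m) (_ , even-n-m) n₀≤n =
  ∣m+n∣m⇒∣n (subst Even split even-n-m) even-n₀-m
  where
  split : n ∸ m ≡ (n₀ ∸ m) + (n ∸ n₀)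
  split = trans (cong (_∸ m) (sym (m+[n∸m]≡n n₀≤n))) (+-∸-comm (n ∸ n₀) m≤n₀)

lemma4p9 : (m : ℕ) (l μ : Partition) → size l ≡ m → size μ ≡ m →
    (n₀ n : ℕ) → n₀ ∈N m → n ∈N m → n₀ < n →
    ∃[ v ] (v ∈V[ n₀ ] l × v ∈V[ n₀ ] μ) →
    ∃[ v ] (v ∈V[ n ] l × v ∈V[ n ] μ)
lemma4p9 m l μ _ _ n₀ n n₀∈N n∈N n₀<n (ν , ν∈Vl , ν∈Vμ) =
  addColumn ν k , reindex (addColumn-∈V ν∈Vl even-k) , reindex (addColumn-∈V ν∈Vμ even-k)
  where
  k : ℕ
  k = n ∸ n₀
  even-k : Even k
  even-k = ∈N-difference-even n₀∈N n∈N (<⇒≤ n₀<n)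
  reindex : ∀ {l′} → addColumn ν k ∈V[ n₀ + k ] l′ → addColumn ν k ∈V[ n ] l′
  reindex = subst (λ n′ → addColumn ν k ∈V[ n′ ] _) (m+[n∸m]≡n (<⇒≤ n₀<n))
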